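{- Let $F(t)=-t^2+t-1$ and $G(t)=t(t^4-2t^3+4t^2-3t+3)$. Let $f,g\in\mathbb{Q}[t]$ with $\deg f=2$, $\deg g=5$. Then $g$ divides $f^3+1$ and $f$ divides $g^3+1$ in $\mathbb{Q}[t]$ if and only if there exist $\alpha\in\mathbb{Q}\setminus\{0\}$ and $\beta\in\mathbb{Q}$ such that $f(t)=F(\alpha t+\beta)$ and $g(t)=G(\alpha t+\beta)$.
   Context: Solutions are considered up to affine reparametrization $t\mapsto\alpha t+\beta$ ($\alpha\in\mathbb{Q}\setminus\{0\}$, $\beta\in\mathbb{Q}$). (Since $\gcd(2,5)=1$, no such pair is a composition with a polynomial of degree at least $2$.) -}

module Defs where

-- Univariate polynomials over ℚ, represented by coefficient lists
-- (lowest degree first). Trailing zeros are allowed; polynomial equality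
-- is therefore the setoid relation _≈ₚ_ (difference has all coefficients 0).

open import Data.Nat using (ℕ; zero; suc; _<_)
open import Data.Integer using (+_)
open import Data.Rational using (ℚ; 0ℚ; 1ℚ; _+_; _*_; -_; _/_)
open import Data.List using (List; []; _∷_)
open import Data.List.Relation.Unary.All using (All)
open import Data.Product using (Σ; _×_)
open import Relation.Binary.PropositionalEquality using (_≡_; _≢_)

Poly : Set
Poly = List ℚ

const : ℚ → Poly
const a = a ∷ []

infixl 6 _+ₚ_ _-ₚ_
infixl 7 _*ₚ_ _·ₚ_

_+ₚ_ : Poly → Poly → Poly
[]       +ₚ q        = q
(a ∷ p)  +ₚ []       = a ∷ p
(a ∷ p)  +ₚ (b ∷ q)  = (a + b) ∷ (p +ₚ q)

_·ₚ_ : ℚ → Poly → Poly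
c ·ₚ []      = []
c ·ₚ (a ∷ p) = (c * a) ∷ (c ·ₚ p)

negₚ : Poly → Poly
negₚ p = (- 1ℚ) ·ₚ p

_-ₚ_ : Poly → Poly → Poly
p -ₚ q = p +ₚ negₚ q

_*ₚ_ : Poly → Poly → Poly
[]      *ₚ q = []
(a ∷ p) *ₚ q = (a ·ₚ q) +ₚ (0ℚ ∷ (p *ₚ q))

cube : Poly → Poly
cube p = p *ₚ p *ₚ p

IsZeroₚ : Poly → Set
IsZeroₚ p = All (_≡ 0ℚ) p

infix 4 _≈ₚ_ _∣ₚ_
_≈ₚ_ : Poly → Poly → Set
p ≈ₚ q = IsZeroₚ (p -ₚ q)

_∣ₚ_ : Poly → Poly → Set
g ∣ₚ h = Σ Poly (λ q → h ≈ₚ q *ₚ g)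

coeff : Poly → ℕ → ℚ
coeff []      _       = 0ℚ
coeff (a ∷ p) zero    = a
coeff (a ∷ p) (suc i) = coeff p i

HasDegree : Poly → ℕ → Set
HasDegree p n = (coeff p n ≢ 0ℚ) × (∀ i → n < i → coeff p i ≡ 0ℚ)

_∘ₚ_ : Poly → Poly → Poly
[]      ∘ₚ q = []
(a ∷ p) ∘ₚ q = const a +ₚ q *ₚ (p ∘ₚ q)

affine : ℚ → ℚ → Poly
affine α β = β ∷ α ∷ []

nat : ℕ → ℚ
nat n = (+ n) / 1

F : Poly
F = (- 1ℚ) ∷ 1ℚ ∷ (- 1ℚ) ∷ []

-- G(t) = t (t^4 - 2t^3 + 4t^2 - 3t + 3) = t^5 - 2t^4 + 4t^3 - 3t^2 + 3t
G : Poly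
G = 0ℚ ∷ nat 3 ∷ (- nat 3) ∷ nat 4 ∷ (- nat 2) ∷ 1ℚ ∷ []

{-# OPTIONS --safe #-}
-- Write Q g = f³ + 1 and R f = g³ + 1. Degrees force Q to be linear with a root x₀, so
-- f(x₀)³ = -1 and f(x₀) = -1. In ℚ[t]/(f), with basis 1 and ε = t - x₀, the two relations
-- say that Q(t) = q₁ ε is inverse to g(t) and that g(t)³ = -1, hence (q₁ ε)³ = -1. Since
-- f(x₀ + ε) = -1 + b ε + a ε² with b = f′(x₀), expanding ε³ yields a = -b² and q₁ = b; then
-- f = F(α t + β) and Q = U(α t + β) for α = -b, β = 1 + b x₀, where U = 1 - t, and cancelling Q
-- from Q g = f³ + 1 = U(α t + β) G(α t + β) gives g = G(α t + β). Conversely the identities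
-- F³ + 1 = U G and G³ + 1 = V F survive the substitution t ↦ α t + β.
module Submission where

open import Level using (0ℓ)
open import Algebra.Bundles using (CommutativeMonoid; CommutativeSemiring; CommutativeRing)
import Algebra.Construct.DirectProduct as DirectProduct
import Algebra.Properties.CommutativeSemigroup
open import Algebra.Structures.Biased using (isCommutativeMonoidˡ; isCommutativeSemiringˡ)
open import Data.Empty using (⊥-elim)
open import Data.List using ([]; _∷_; length; applyUpTo)
open import Data.List.Relation.Unary.All using ([]; _∷_; all?)
open import Data.Nat as ℕ using (ℕ; zero; suc; s≤s; z≤n)
import Data.Nat.Properties as ℕ
open import Data.Product using (Σ; _×_; _,_; proj₁; proj₂)
open import Data.Rational
  using (ℚ; 0ℚ; 1ℚ; _+_; _*_; -_; _-_; 1/_; _<_; _≤_; _≟_; ≢-nonZero; positive; negative)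
import Data.Rational.Properties as ℚ
open import Data.Sum using (inj₁; inj₂)
open import Function.Base using (_∘_)
open import Function.Bundles using (_⇔_; mk⇔)
open import Relation.Binary using (tri<; tri≈; tri>; IsEquivalence; Setoid)
open import Relation.Binary.PropositionalEquality
  using (_≡_; _≢_; refl; sym; trans; cong; cong₂; subst; module ≡-Reasoning)
import Relation.Binary.Reasoning.Setoid
open import Relation.Nullary using (yes; no)
open import Relation.Nullary.Decidable using (dec⇒maybe; True; toWitness)
open import Tactic.RingSolver using (solve-∀)
open import Tactic.RingSolver.Core.AlmostCommutativeRing using (AlmostCommutativeRing; fromCommutativeRing)

open import Defs

ℚ-ring : AlmostCommutativeRing 0ℓ 0ℓ
ℚ-ring = fromCommutativeRing ℚ.+-*-commutativeRing (λ x → dec⇒maybe (0ℚ ≟ x))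

x≢0∧x*y≡0⇒y≡0 : ∀ {x y} → x ≢ 0ℚ → x * y ≡ 0ℚ → y ≡ 0ℚ
x≢0∧x*y≡0⇒y≡0 {x} {y} x≢0 xy≡0 = begin
  y                ≡⟨ sym (ℚ.*-identityˡ y) ⟩
  1ℚ * y           ≡⟨ cong (_* y) (sym (ℚ.*-inverseˡ x)) ⟩
  1/ x * x * y     ≡⟨ ℚ.*-assoc (1/ x) x y ⟩
  1/ x * (x * y)   ≡⟨ cong (1/ x *_) xy≡0 ⟩
  1/ x * 0ℚ        ≡⟨ ℚ.*-zeroʳ (1/ x) ⟩
  0ℚ               ∎
  where
  open ≡-Reasoning
  instance _ = ≢-nonZero x≢0

y≢0∧x*y≡0⇒x≡0 : ∀ {x y} → y ≢ 0ℚ → x * y ≡ 0ℚ → x ≡ 0ℚ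
y≢0∧x*y≡0⇒x≡0 {x} {y} y≢0 xy≡0 = x≢0∧x*y≡0⇒y≡0 y≢0 (trans (ℚ.*-comm y x) xy≡0)

x≢0∧y≢0⇒x*y≢0 : ∀ {x y} → x ≢ 0ℚ → y ≢ 0ℚ → x * y ≢ 0ℚ
x≢0∧y≢0⇒x*y≢0 x≢0 y≢0 xy≡0 = y≢0 (x≢0∧x*y≡0⇒y≡0 x≢0 xy≡0)

x≢0⇒x³≢0 : ∀ {x} → x ≢ 0ℚ → x * x * x ≢ 0ℚ
x≢0⇒x³≢0 x≢0 = x≢0∧y≢0⇒x*y≢0 (x≢0∧y≢0⇒x*y≢0 x≢0 x≢0) x≢0

x≢0⇒0<x*x : ∀ {x} → x ≢ 0ℚ → 0ℚ < x * x
x≢0⇒0<x*x {x} x≢0 with ℚ.<-cmp x 0ℚ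
... | tri< x<0 _ _ = ℚ.positive⁻¹ (x * x) {{ℚ.neg*neg⇒pos x {{negative x<0}} x {{negative x<0}}}}
... | tri≈ _ x≡0 _ = ⊥-elim (x≢0 x≡0)
... | tri> _ _ x>0 = ℚ.positive⁻¹ (x * x) {{ℚ.pos*pos⇒pos x {{positive x>0}} x {{positive x>0}}}}

0≤x*x : ∀ x → 0ℚ ≤ x * x
0≤x*x x with x ≟ 0ℚ
... | yes refl = ℚ.≤-refl
... | no x≢0   = ℚ.<⇒≤ (x≢0⇒0<x*x x≢0)

u²+3v²≡0⇒v≡0 : ∀ u v → u * u + (v * v + v * v + v * v) ≡ 0ℚ → v ≡ 0ℚ
u²+3v²≡0⇒v≡0 u v eq with v ≟ 0ℚ
... | yes v≡0 = v≡0
... | no v≢0  = ⊥-elim (ℚ.<⇒≢ 0<sum (sym eq))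
  where
  0<sum : 0ℚ < u * u + (v * v + v * v + v * v)
  0<sum = ℚ.+-mono-≤-< (0≤x*x u)
            (ℚ.+-mono-<-≤ (ℚ.+-mono-<-≤ (x≢0⇒0<x*x v≢0) (0≤x*x v)) (0≤x*x v))

x-y≡0⇒x≡y : ∀ {x y} → x - y ≡ 0ℚ → x ≡ y
x-y≡0⇒x≡y {x} {y} x-y≡0 = trans (x≡[x-y]+y x y) (trans (cong (_+ y) x-y≡0) (ℚ.+-identityˡ y))
  where
  x≡[x-y]+y : ∀ x y → x ≡ (x - y) + y
  x≡[x-y]+y = solve-∀ ℚ-ring

x³≡0⇒x≡0 : ∀ {x} → x * x * x ≡ 0ℚ → x ≡ 0ℚ
x³≡0⇒x≡0 {x} x³≡0 with x ≟ 0ℚ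
... | yes x≡0 = x≡0
... | no x≢0  = ⊥-elim (x≢0⇒x³≢0 x≢0 x³≡0)

-- 4 (x³ - y³) = (x - y) ((2x + y)² + 3y²), and the second factor vanishes only at x = y = 0.
cube-injective : ∀ {x y} → x * x * x ≡ y * y * y → x ≡ y
cube-injective {x} {y} x³≡y³ with x - y ≟ 0ℚ
... | yes x-y≡0 = x-y≡0⇒x≡y x-y≡0
... | no x-y≢0 = trans (x³≡0⇒x≡0 (trans x³≡y³ y³≡0)) (sym y≡0)
  where
  open ≡-Reasoning
  factor : ∀ x y → (x - y) * ((x + x + y) * (x + x + y) + (y * y + y * y + y * y))
                 ≡ (x * x * x - y * y * y) * nat 4
  factor = solve-∀ ℚ-ring
  y≡0 : y ≡ 0ℚ
  y≡0 = u²+3v²≡0⇒v≡0 (x + x + y) y (x≢0∧x*y≡0⇒y≡0 x-y≢0 (begin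
    (x - y) * ((x + x + y) * (x + x + y) + (y * y + y * y + y * y)) ≡⟨ factor x y ⟩
    (x * x * x - y * y * y) * nat 4                                  ≡⟨ cong (λ c → (c - y * y * y) * nat 4) x³≡y³ ⟩
    (y * y * y - y * y * y) * nat 4                                  ≡⟨ cong (_* nat 4) (ℚ.+-inverseʳ (y * y * y)) ⟩
    0ℚ * nat 4                                                       ≡⟨ ℚ.*-zeroˡ (nat 4) ⟩
    0ℚ                                                               ∎))
  y³≡0 : y * y * y ≡ 0ℚ
  y³≡0 = cong (λ c → c * c * c) y≡0

x³+1≡0⇒x≡-1 : ∀ {x} → x * x * x + 1ℚ ≡ 0ℚ → x ≡ - 1ℚ
x³+1≡0⇒x≡-1 {x} x³+1≡0 = cube-injective (x-y≡0⇒x≡y (trans (x³-[-1]³≡x³+1 x) x³+1≡0))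
  where
  x³-[-1]³≡x³+1 : ∀ x → x * x * x - (- 1ℚ) * (- 1ℚ) * (- 1ℚ) ≡ x * x * x + 1ℚ
  x³-[-1]³≡x³+1 = solve-∀ ℚ-ring

linear-root : ∀ a b → b ≢ 0ℚ → Σ ℚ λ x → a + x * b ≡ 0ℚ
linear-root a b b≢0 = - (a * 1/ b) , (begin
  a + - (a * 1/ b) * b   ≡⟨ a-a[b⁻¹b] a (1/ b) b ⟩
  a * (1ℚ - 1/ b * b)    ≡⟨ cong (λ t → a * (1ℚ - t)) (ℚ.*-inverseˡ b) ⟩
  a * (1ℚ - 1ℚ)          ≡⟨ a[1-1]≡0 a ⟩
  0ℚ                     ∎)
  where
  open ≡-Reasoning
  instance _ = ≢-nonZero b≢0
  a-a[b⁻¹b] : ∀ a c b → a + - (a * c) * b ≡ a * (1ℚ - c * b)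
  a-a[b⁻¹b] = solve-∀ ℚ-ring
  a[1-1]≡0 : ∀ a → a * (1ℚ - 1ℚ) ≡ 0ℚ
  a[1-1]≡0 = solve-∀ ℚ-ring

infix 4 _≋_
record _≋_ (p q : Poly) : Set where
  constructor mk≋
  field coeff-≡ : ∀ i → coeff p i ≡ coeff q i
open _≋_

≋-refl : ∀ {p} → p ≋ p
≋-refl = mk≋ λ _ → refl

≋-sym : ∀ {p q} → p ≋ q → q ≋ p
≋-sym p≋q = mk≋ λ i → sym (coeff-≡ p≋q i)

≋-trans : ∀ {p q r} → p ≋ q → q ≋ r → p ≋ r
≋-trans p≋q q≋r = mk≋ λ i → trans (coeff-≡ p≋q i) (coeff-≡ q≋r i)

≋-isEquivalence : IsEquivalence _≋_
≋-isEquivalence = record { refl = ≋-refl ; sym = ≋-sym ; trans = ≋-trans }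

≋-setoid : Setoid 0ℓ 0ℓ
≋-setoid = record { isEquivalence = ≋-isEquivalence }

module ≋-Reasoning = Relation.Binary.Reasoning.Setoid ≋-setoid

∷-cong : ∀ {a b p q} → a ≡ b → p ≋ q → a ∷ p ≋ b ∷ q
∷-cong a≡b p≋q = mk≋ λ { zero → a≡b ; (suc i) → coeff-≡ p≋q i }

coeff-+ₚ : ∀ p q i → coeff (p +ₚ q) i ≡ coeff p i + coeff q i
coeff-+ₚ []      q       i       = sym (ℚ.+-identityˡ _)
coeff-+ₚ (a ∷ p) []      i       = sym (ℚ.+-identityʳ _)
coeff-+ₚ (a ∷ p) (b ∷ q) zero    = refl
coeff-+ₚ (a ∷ p) (b ∷ q) (suc i) = coeff-+ₚ p q i

coeff-·ₚ : ∀ c p i → coeff (c ·ₚ p) i ≡ c * coeff p i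
coeff-·ₚ c []      i       = sym (ℚ.*-zeroʳ c)
coeff-·ₚ c (a ∷ p) zero    = refl
coeff-·ₚ c (a ∷ p) (suc i) = coeff-·ₚ c p i

coeff-*ₚ : ∀ a p q i → coeff ((a ∷ p) *ₚ q) i ≡ a * coeff q i + coeff (0ℚ ∷ p *ₚ q) i
coeff-*ₚ a p q i = trans (coeff-+ₚ (a ·ₚ q) _ i) (cong (_+ _) (coeff-·ₚ a q i))

∷-injective : ∀ {a b p q} → a ∷ p ≋ b ∷ q → a ≡ b × p ≋ q
∷-injective a∷p≋b∷q = coeff-≡ a∷p≋b∷q 0 , mk≋ λ i → coeff-≡ a∷p≋b∷q (suc i)

∷-≋[] : ∀ {a p} → a ≡ 0ℚ → p ≋ [] → a ∷ p ≋ []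
∷-≋[] a≡0 p≋[] = mk≋ λ { zero → a≡0 ; (suc i) → coeff-≡ p≋[] i }

∷-≋[]⁻¹ : ∀ {a p} → a ∷ p ≋ [] → a ≡ 0ℚ × p ≋ []
∷-≋[]⁻¹ a∷p≋[] = coeff-≡ a∷p≋[] 0 , mk≋ λ i → coeff-≡ a∷p≋[] (suc i)

IsZeroₚ⇒≋[] : ∀ {p} → IsZeroₚ p → p ≋ []
IsZeroₚ⇒≋[] []          = ≋-refl
IsZeroₚ⇒≋[] (a≡0 ∷ p≡0) = ∷-≋[] a≡0 (IsZeroₚ⇒≋[] p≡0)

≋[]⇒IsZeroₚ : ∀ {p} → p ≋ [] → IsZeroₚ p
≋[]⇒IsZeroₚ {[]}    _      = []
≋[]⇒IsZeroₚ {a ∷ p} a∷p≋[] = proj₁ (∷-≋[]⁻¹ a∷p≋[]) ∷ ≋[]⇒IsZeroₚ (proj₂ (∷-≋[]⁻¹ a∷p≋[]))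

coeff--ₚ : ∀ p q i → coeff (p -ₚ q) i ≡ coeff p i - coeff q i
coeff--ₚ p q i = begin
  coeff (p -ₚ q) i                ≡⟨ coeff-+ₚ p (negₚ q) i ⟩
  coeff p i + coeff (negₚ q) i    ≡⟨ cong (coeff p i +_) (coeff-·ₚ (- 1ℚ) q i) ⟩
  coeff p i + - 1ℚ * coeff q i    ≡⟨ x+-1*y≡x-y (coeff p i) (coeff q i) ⟩
  coeff p i - coeff q i           ∎
  where
  open ≡-Reasoning
  x+-1*y≡x-y : ∀ x y → x + - 1ℚ * y ≡ x - y
  x+-1*y≡x-y = solve-∀ ℚ-ring

≈ₚ⇒≋ : ∀ {p q} → p ≈ₚ q → p ≋ q
≈ₚ⇒≋ {p} {q} p≈q = mk≋ λ i →
  x-y≡0⇒x≡y (trans (sym (coeff--ₚ p q i)) (coeff-≡ (IsZeroₚ⇒≋[] p≈q) i))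

≋⇒≈ₚ : ∀ {p q} → p ≋ q → p ≈ₚ q
≋⇒≈ₚ {p} {q} p≋q = ≋[]⇒IsZeroₚ (mk≋ λ i →
  trans (coeff--ₚ p q i) (trans (cong (_- coeff q i) (coeff-≡ p≋q i)) (ℚ.+-inverseʳ (coeff q i))))

+ₚ-cong : ∀ {p p′ q q′} → p ≋ p′ → q ≋ q′ → p +ₚ q ≋ p′ +ₚ q′
+ₚ-cong {p} {p′} {q} {q′} p≋p′ q≋q′ = mk≋ λ i → begin
  coeff (p +ₚ q) i        ≡⟨ coeff-+ₚ p q i ⟩
  coeff p i + coeff q i   ≡⟨ cong₂ _+_ (coeff-≡ p≋p′ i) (coeff-≡ q≋q′ i) ⟩
  coeff p′ i + coeff q′ i ≡⟨ coeff-+ₚ p′ q′ i ⟨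
  coeff (p′ +ₚ q′) i      ∎
  where open ≡-Reasoning

+ₚ-assoc : ∀ p q r → (p +ₚ q) +ₚ r ≋ p +ₚ (q +ₚ r)
+ₚ-assoc p q r = mk≋ λ i → begin
  coeff (p +ₚ q +ₚ r) i                 ≡⟨ coeff-+ₚ (p +ₚ q) r i ⟩
  coeff (p +ₚ q) i + coeff r i          ≡⟨ cong (_+ coeff r i) (coeff-+ₚ p q i) ⟩
  coeff p i + coeff q i + coeff r i     ≡⟨ ℚ.+-assoc (coeff p i) (coeff q i) (coeff r i) ⟩
  coeff p i + (coeff q i + coeff r i)   ≡⟨ cong (coeff p i +_) (coeff-+ₚ q r i) ⟨
  coeff p i + coeff (q +ₚ r) i          ≡⟨ coeff-+ₚ p (q +ₚ r) i ⟨
  coeff (p +ₚ (q +ₚ r)) i               ∎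
  where open ≡-Reasoning

+ₚ-comm : ∀ p q → p +ₚ q ≋ q +ₚ p
+ₚ-comm p q = mk≋ λ i → begin
  coeff (p +ₚ q) i       ≡⟨ coeff-+ₚ p q i ⟩
  coeff p i + coeff q i  ≡⟨ ℚ.+-comm (coeff p i) (coeff q i) ⟩
  coeff q i + coeff p i  ≡⟨ coeff-+ₚ q p i ⟨
  coeff (q +ₚ p) i       ∎
  where open ≡-Reasoning

+ₚ-identityʳ : ∀ p → p +ₚ [] ≋ p
+ₚ-identityʳ p = mk≋ λ i → trans (coeff-+ₚ p [] i) (ℚ.+-identityʳ (coeff p i))

+ₚ-commutativeMonoid : CommutativeMonoid 0ℓ 0ℓ
+ₚ-commutativeMonoid = record
  { isCommutativeMonoid = isCommutativeMonoidˡ record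
    { isSemigroup = record
      { isMagma = record { isEquivalence = ≋-isEquivalence ; ∙-cong = +ₚ-cong }
      ; assoc   = +ₚ-assoc
      }
    ; identityˡ = λ _ → ≋-refl
    ; comm      = +ₚ-comm
    }
  }

module +ₚ = Algebra.Properties.CommutativeSemigroup
  (CommutativeMonoid.commutativeSemigroup +ₚ-commutativeMonoid)

·ₚ-cong : ∀ c {p q} → p ≋ q → c ·ₚ p ≋ c ·ₚ q
·ₚ-cong c {p} {q} p≋q = mk≋ λ i →
  trans (coeff-·ₚ c p i) (trans (cong (c *_) (coeff-≡ p≋q i)) (sym (coeff-·ₚ c q i)))

·ₚ-zeroˡ : ∀ p → 0ℚ ·ₚ p ≋ []
·ₚ-zeroˡ p = mk≋ λ i → trans (coeff-·ₚ 0ℚ p i) (ℚ.*-zeroˡ (coeff p i))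

·ₚ-assoc : ∀ c d p → (c * d) ·ₚ p ≋ c ·ₚ (d ·ₚ p)
·ₚ-assoc c d p = mk≋ λ i → begin
  coeff ((c * d) ·ₚ p) i   ≡⟨ coeff-·ₚ (c * d) p i ⟩
  c * d * coeff p i        ≡⟨ ℚ.*-assoc c d (coeff p i) ⟩
  c * (d * coeff p i)      ≡⟨ cong (c *_) (coeff-·ₚ d p i) ⟨
  c * coeff (d ·ₚ p) i     ≡⟨ coeff-·ₚ c (d ·ₚ p) i ⟨
  coeff (c ·ₚ (d ·ₚ p)) i  ∎
  where open ≡-Reasoning

·ₚ-distribˡ : ∀ c p q → c ·ₚ (p +ₚ q) ≋ c ·ₚ p +ₚ c ·ₚ q
·ₚ-distribˡ c p q = mk≋ λ i → begin
  coeff (c ·ₚ (p +ₚ q)) i                  ≡⟨ coeff-·ₚ c (p +ₚ q) i ⟩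
  c * coeff (p +ₚ q) i                     ≡⟨ cong (c *_) (coeff-+ₚ p q i) ⟩
  c * (coeff p i + coeff q i)              ≡⟨ ℚ.*-distribˡ-+ c (coeff p i) (coeff q i) ⟩
  c * coeff p i + c * coeff q i            ≡⟨ cong₂ _+_ (coeff-·ₚ c p i) (coeff-·ₚ c q i) ⟨
  coeff (c ·ₚ p) i + coeff (c ·ₚ q) i      ≡⟨ coeff-+ₚ (c ·ₚ p) (c ·ₚ q) i ⟨
  coeff (c ·ₚ p +ₚ c ·ₚ q) i               ∎
  where open ≡-Reasoning

·ₚ-distribʳ : ∀ c d p → (c + d) ·ₚ p ≋ c ·ₚ p +ₚ d ·ₚ p
·ₚ-distribʳ c d p = mk≋ λ i → begin
  coeff ((c + d) ·ₚ p) i                   ≡⟨ coeff-·ₚ (c + d) p i ⟩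
  (c + d) * coeff p i                      ≡⟨ ℚ.*-distribʳ-+ (coeff p i) c d ⟩
  c * coeff p i + d * coeff p i            ≡⟨ cong₂ _+_ (coeff-·ₚ c p i) (coeff-·ₚ d p i) ⟨
  coeff (c ·ₚ p) i + coeff (d ·ₚ p) i      ≡⟨ coeff-+ₚ (c ·ₚ p) (d ·ₚ p) i ⟨
  coeff (c ·ₚ p +ₚ d ·ₚ p) i               ∎
  where open ≡-Reasoning

0∷-+ₚ : ∀ p q → 0ℚ ∷ (p +ₚ q) ≋ (0ℚ ∷ p) +ₚ (0ℚ ∷ q)
0∷-+ₚ p q = ∷-cong (sym (ℚ.+-identityˡ 0ℚ)) ≋-refl

0∷-*ₚ : ∀ p q → (0ℚ ∷ p) *ₚ q ≋ 0ℚ ∷ p *ₚ q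
0∷-*ₚ p q = +ₚ-cong (·ₚ-zeroˡ q) ≋-refl

·ₚ-0∷ : ∀ c p → c ·ₚ (0ℚ ∷ p) ≋ 0ℚ ∷ c ·ₚ p
·ₚ-0∷ c p = ∷-cong (ℚ.*-zeroʳ c) ≋-refl

≋-reflexive : ∀ {p q} → p ≡ q → p ≋ q
≋-reflexive refl = ≋-refl

≋[]⇒*ₚ≋[] : ∀ p q → p ≋ [] → p *ₚ q ≋ []
≋[]⇒*ₚ≋[] []      q _      = ≋-refl
≋[]⇒*ₚ≋[] (a ∷ p) q a∷p≋[] = +ₚ-cong a·q≋[] (∷-≋[] refl (≋[]⇒*ₚ≋[] p q p≋[]))
  where
  a≡0 : a ≡ 0ℚ
  a≡0 = proj₁ (∷-≋[]⁻¹ a∷p≋[])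
  p≋[] : p ≋ []
  p≋[] = proj₂ (∷-≋[]⁻¹ a∷p≋[])
  a·q≋[] : a ·ₚ q ≋ []
  a·q≋[] = ≋-trans (≋-reflexive (cong (_·ₚ q) a≡0)) (·ₚ-zeroˡ q)

*ₚ-congˡ : ∀ {p p′} q → p ≋ p′ → p *ₚ q ≋ p′ *ₚ q
*ₚ-congˡ {[]}    {[]}     q _     = ≋-refl
*ₚ-congˡ {[]}    {b ∷ p′} q p≋p′ = ≋-sym (≋[]⇒*ₚ≋[] (b ∷ p′) q (≋-sym p≋p′))
*ₚ-congˡ {a ∷ p} {[]}     q p≋p′ = ≋[]⇒*ₚ≋[] (a ∷ p) q p≋p′
*ₚ-congˡ {a ∷ p} {b ∷ p′} q p≋p′ =
  +ₚ-cong (≋-reflexive (cong (_·ₚ q) (proj₁ (∷-injective p≋p′))))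
          (∷-cong refl (*ₚ-congˡ q (proj₂ (∷-injective p≋p′))))

*ₚ-congʳ : ∀ p {q q′} → q ≋ q′ → p *ₚ q ≋ p *ₚ q′
*ₚ-congʳ []      q≋q′ = ≋-refl
*ₚ-congʳ (a ∷ p) q≋q′ = +ₚ-cong (·ₚ-cong a q≋q′) (∷-cong refl (*ₚ-congʳ p q≋q′))

*ₚ-cong : ∀ {p p′ q q′} → p ≋ p′ → q ≋ q′ → p *ₚ q ≋ p′ *ₚ q′
*ₚ-cong {p′ = p′} {q = q} p≋p′ q≋q′ = ≋-trans (*ₚ-congˡ q p≋p′) (*ₚ-congʳ p′ q≋q′)

*ₚ-zeroʳ : ∀ p → p *ₚ [] ≋ []
*ₚ-zeroʳ []      = ≋-refl
*ₚ-zeroʳ (a ∷ p) = ∷-≋[] refl (*ₚ-zeroʳ p)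

*ₚ-consʳ : ∀ p b q → p *ₚ (b ∷ q) ≋ b ·ₚ p +ₚ (0ℚ ∷ p *ₚ q)
*ₚ-consʳ []      b q = mk≋ λ { zero → refl ; (suc i) → refl }
*ₚ-consʳ (a ∷ p) b q = ∷-cong (cong (_+ 0ℚ) (ℚ.*-comm a b)) (begin
  a ·ₚ q +ₚ p *ₚ (b ∷ q)                   ≈⟨ +ₚ-cong ≋-refl (*ₚ-consʳ p b q) ⟩
  a ·ₚ q +ₚ (b ·ₚ p +ₚ (0ℚ ∷ p *ₚ q))      ≈⟨ +ₚ.x∙yz≈y∙xz (a ·ₚ q) (b ·ₚ p) _ ⟩
  b ·ₚ p +ₚ (a ·ₚ q +ₚ (0ℚ ∷ p *ₚ q))      ∎)
  where open ≋-Reasoning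

*ₚ-comm : ∀ p q → p *ₚ q ≋ q *ₚ p
*ₚ-comm []      q = ≋-sym (*ₚ-zeroʳ q)
*ₚ-comm (a ∷ p) q = ≋-trans (+ₚ-cong ≋-refl (∷-cong refl (*ₚ-comm p q))) (≋-sym (*ₚ-consʳ q a p))

·ₚ-*ₚ : ∀ c p q → (c ·ₚ p) *ₚ q ≋ c ·ₚ (p *ₚ q)
·ₚ-*ₚ c []      q = ≋-refl
·ₚ-*ₚ c (a ∷ p) q = begin
  (c * a) ·ₚ q +ₚ (0ℚ ∷ (c ·ₚ p) *ₚ q)     ≈⟨ +ₚ-cong (·ₚ-assoc c a q) (∷-cong refl (·ₚ-*ₚ c p q)) ⟩
  c ·ₚ (a ·ₚ q) +ₚ (0ℚ ∷ c ·ₚ (p *ₚ q))    ≈⟨ +ₚ-cong ≋-refl (≋-sym (·ₚ-0∷ c (p *ₚ q))) ⟩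
  c ·ₚ (a ·ₚ q) +ₚ c ·ₚ (0ℚ ∷ p *ₚ q)      ≈⟨ ·ₚ-distribˡ c (a ·ₚ q) _ ⟨
  c ·ₚ (a ·ₚ q +ₚ (0ℚ ∷ p *ₚ q))           ∎
  where open ≋-Reasoning

*ₚ-distribʳ : ∀ r p q → (p +ₚ q) *ₚ r ≋ p *ₚ r +ₚ q *ₚ r
*ₚ-distribʳ r []      q       = ≋-refl
*ₚ-distribʳ r (a ∷ p) []      = ≋-sym (+ₚ-identityʳ ((a ∷ p) *ₚ r))
*ₚ-distribʳ r (a ∷ p) (b ∷ q) = begin
  (a + b) ·ₚ r +ₚ (0ℚ ∷ (p +ₚ q) *ₚ r)
    ≈⟨ +ₚ-cong (·ₚ-distribʳ a b r) (∷-cong refl (*ₚ-distribʳ r p q)) ⟩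
  (a ·ₚ r +ₚ b ·ₚ r) +ₚ (0ℚ ∷ p *ₚ r +ₚ q *ₚ r)
    ≈⟨ +ₚ-cong ≋-refl (0∷-+ₚ (p *ₚ r) (q *ₚ r)) ⟩
  (a ·ₚ r +ₚ b ·ₚ r) +ₚ ((0ℚ ∷ p *ₚ r) +ₚ (0ℚ ∷ q *ₚ r))
    ≈⟨ +ₚ.interchange (a ·ₚ r) (b ·ₚ r) _ _ ⟩
  (a ·ₚ r +ₚ (0ℚ ∷ p *ₚ r)) +ₚ (b ·ₚ r +ₚ (0ℚ ∷ q *ₚ r))
    ∎
  where open ≋-Reasoning

*ₚ-assoc : ∀ p q r → (p *ₚ q) *ₚ r ≋ p *ₚ (q *ₚ r)
*ₚ-assoc []      q r = ≋-refl
*ₚ-assoc (a ∷ p) q r = begin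
  (a ·ₚ q +ₚ (0ℚ ∷ p *ₚ q)) *ₚ r          ≈⟨ *ₚ-distribʳ r (a ·ₚ q) _ ⟩
  (a ·ₚ q) *ₚ r +ₚ (0ℚ ∷ p *ₚ q) *ₚ r     ≈⟨ +ₚ-cong (·ₚ-*ₚ a q r) (0∷-*ₚ (p *ₚ q) r) ⟩
  a ·ₚ (q *ₚ r) +ₚ (0ℚ ∷ (p *ₚ q) *ₚ r)   ≈⟨ +ₚ-cong ≋-refl (∷-cong refl (*ₚ-assoc p q r)) ⟩
  a ·ₚ (q *ₚ r) +ₚ (0ℚ ∷ p *ₚ (q *ₚ r))   ∎
  where open ≋-Reasoning

*ₚ-identityˡ : ∀ p → const 1ℚ *ₚ p ≋ p
*ₚ-identityˡ p = mk≋ λ i → begin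
  coeff (1ℚ ·ₚ p +ₚ (0ℚ ∷ [])) i       ≡⟨ coeff-+ₚ (1ℚ ·ₚ p) (0ℚ ∷ []) i ⟩
  coeff (1ℚ ·ₚ p) i + coeff (0ℚ ∷ []) i ≡⟨ cong₂ _+_ (coeff-·ₚ 1ℚ p i) (coeff-0∷[] i) ⟩
  1ℚ * coeff p i + 0ℚ                  ≡⟨ ℚ.+-identityʳ _ ⟩
  1ℚ * coeff p i                       ≡⟨ ℚ.*-identityˡ (coeff p i) ⟩
  coeff p i                            ∎
  where
  open ≡-Reasoning
  coeff-0∷[] : ∀ i → coeff (0ℚ ∷ []) i ≡ 0ℚ
  coeff-0∷[] zero    = refl
  coeff-0∷[] (suc i) = refl

Poly-commutativeSemiring : CommutativeSemiring 0ℓ 0ℓ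
Poly-commutativeSemiring = record
  { Carrier = Poly
  ; _≈_ = _≋_
  ; _+_ = _+ₚ_
  ; _*_ = _*ₚ_
  ; 0# = []
  ; 1# = const 1ℚ
  ; isCommutativeSemiring = isCommutativeSemiringˡ record
    { +-isCommutativeMonoid = CommutativeMonoid.isCommutativeMonoid +ₚ-commutativeMonoid
    ; *-isCommutativeMonoid = isCommutativeMonoidˡ record
      { isSemigroup = record
        { isMagma = record { isEquivalence = ≋-isEquivalence ; ∙-cong = *ₚ-cong }
        ; assoc   = *ₚ-assoc
        }
      ; identityˡ = *ₚ-identityˡ
      ; comm      = *ₚ-comm
      }
    ; distribʳ = *ₚ-distribʳ
    ; zeroˡ    = λ _ → ≋-refl
    }
  }

DegreeAtMost : Poly → ℕ → Set
DegreeAtMost p n = ∀ i → n ℕ.< i → coeff p i ≡ 0ℚ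

DegreeAtMost-cong : ∀ {p q n} → p ≋ q → DegreeAtMost p n → DegreeAtMost q n
DegreeAtMost-cong p≋q p≤n i n<i = trans (sym (coeff-≡ p≋q i)) (p≤n i n<i)

DegreeAtMost-length : ∀ p → DegreeAtMost p (length p)
DegreeAtMost-length []      i       _           = refl
DegreeAtMost-length (a ∷ p) (suc i) (s≤s len<i) = DegreeAtMost-length p i len<i

DegreeAtMost-≤ : ∀ {p m n} → m ℕ.≤ n → DegreeAtMost p m → DegreeAtMost p n
DegreeAtMost-≤ m≤n p≤m i n<i = p≤m i (ℕ.<-≤-trans (s≤s m≤n) n<i)

DegreeAtMost-0⇒≋const : ∀ {p} → DegreeAtMost p 0 → p ≋ const (coeff p 0)
DegreeAtMost-0⇒≋const {[]}    p≤0 = mk≋ λ { zero → refl ; (suc i) → refl }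
DegreeAtMost-0⇒≋const {a ∷ p} p≤0 = ∷-cong refl (mk≋ λ i → p≤0 (suc i) (s≤s z≤n))

coeff-*ₚ-top : ∀ p q m n → DegreeAtMost p m → DegreeAtMost q n →
               coeff (p *ₚ q) (m ℕ.+ n) ≡ coeff p m * coeff q n
coeff-*ₚ-top []      q m       n p≤m q≤n = sym (ℚ.*-zeroˡ (coeff q n))
coeff-*ₚ-top (a ∷ p) q zero    n p≤0 q≤n = begin
  coeff ((a ∷ p) *ₚ q) n              ≡⟨ coeff-*ₚ a p q n ⟩
  a * coeff q n + coeff (0ℚ ∷ p *ₚ q) n ≡⟨ cong (a * coeff q n +_) (coeff-≡ 0∷pq≋[] n) ⟩
  a * coeff q n + 0ℚ                  ≡⟨ ℚ.+-identityʳ _ ⟩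
  a * coeff q n                       ∎
  where
  open ≡-Reasoning
  0∷pq≋[] : 0ℚ ∷ p *ₚ q ≋ []
  0∷pq≋[] = ∷-≋[] refl (≋[]⇒*ₚ≋[] p q (mk≋ λ i → p≤0 (suc i) (s≤s z≤n)))
coeff-*ₚ-top (a ∷ p) q (suc m) n p≤m+1 q≤n = begin
  coeff ((a ∷ p) *ₚ q) (suc (m ℕ.+ n))        ≡⟨ coeff-*ₚ a p q (suc (m ℕ.+ n)) ⟩
  a * coeff q (suc (m ℕ.+ n)) + coeff (p *ₚ q) (m ℕ.+ n)
    ≡⟨ cong₂ _+_ (cong (a *_) (q≤n _ (s≤s (ℕ.m≤n+m n m))))
                 (coeff-*ₚ-top p q m n (λ i m<i → p≤m+1 (suc i) (s≤s m<i)) q≤n) ⟩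
  a * 0ℚ + coeff p m * coeff q n              ≡⟨ cong (_+ _) (ℚ.*-zeroʳ a) ⟩
  0ℚ + coeff p m * coeff q n                  ≡⟨ ℚ.+-identityˡ _ ⟩
  coeff p m * coeff q n                       ∎
  where open ≡-Reasoning

-- Starting from the trivial bound deg p ≤ m + length p, lower it one step at a time:
-- the top coefficient of p q is the top coefficient of p times qₙ ≠ 0.
*ₚ-DegreeAtMost-cancelʳ : ∀ {p q} m n → HasDegree q n → DegreeAtMost (p *ₚ q) (m ℕ.+ n) → DegreeAtMost p m
*ₚ-DegreeAtMost-cancelʳ {p} {q} m n (qₙ≢0 , q≤n) pq≤m+n =
  lower (length p) (DegreeAtMost-≤ {p} (ℕ.m≤n+m (length p) m) (DegreeAtMost-length p))
  where
  lower : ∀ d → DegreeAtMost p (m ℕ.+ d) → DegreeAtMost p m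
  lower zero    p≤m+0     = subst (DegreeAtMost p) (ℕ.+-identityʳ m) p≤m+0
  lower (suc d) p≤m+d+1 = lower d p≤m+d
    where
    p≤m+d : DegreeAtMost p (m ℕ.+ d)
    p≤m+d i m+d<i with ℕ.m≤n⇒m<n∨m≡n m+d<i
    ... | inj₁ m+d+1<i = p≤m+d+1 i (subst (ℕ._< i) (sym (ℕ.+-suc m d)) m+d+1<i)
    ... | inj₂ refl    = y≢0∧x*y≡0⇒x≡0 qₙ≢0 (begin
      coeff p (suc (m ℕ.+ d)) * coeff q n       ≡⟨ coeff-*ₚ-top p q (suc (m ℕ.+ d)) n p≤m+d+1′ q≤n ⟨
      coeff (p *ₚ q) (suc (m ℕ.+ d) ℕ.+ n)      ≡⟨ pq≤m+n _ (ℕ.+-monoˡ-< n (s≤s (ℕ.m≤m+n m d))) ⟩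
      0ℚ                                        ∎)
      where
      open ≡-Reasoning
      p≤m+d+1′ : DegreeAtMost p (suc (m ℕ.+ d))
      p≤m+d+1′ = subst (DegreeAtMost p) (ℕ.+-suc m d) p≤m+d+1

*ₚ-≋[]-cancelʳ : ∀ {p q} n → HasDegree q n → p *ₚ q ≋ [] → p ≋ []
*ₚ-≋[]-cancelʳ {p} {q} n q≡n pq≋[] = ≋-trans (DegreeAtMost-0⇒≋const p≤0) (∷-≋[] p₀≡0 ≋-refl)
  where
  p≤0 : DegreeAtMost p 0
  p≤0 = *ₚ-DegreeAtMost-cancelʳ {p} {q} 0 n q≡n (λ i _ → coeff-≡ pq≋[] i)
  p₀≡0 : coeff p 0 ≡ 0ℚ
  p₀≡0 = y≢0∧x*y≡0⇒x≡0 (proj₁ q≡n)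
           (trans (sym (coeff-*ₚ-top p q 0 n p≤0 (proj₂ q≡n))) (coeff-≡ pq≋[] n))

-ₚ-self : ∀ p → p -ₚ p ≋ []
-ₚ-self p = IsZeroₚ⇒≋[] (≋⇒≈ₚ {p} ≋-refl)

*ₚ-cancelˡ : ∀ {h p q} n → HasDegree h n → h *ₚ p ≋ h *ₚ q → p ≋ q
*ₚ-cancelˡ {h} {p} {q} n h≡n hp≋hq = ≈ₚ⇒≋ (≋[]⇒IsZeroₚ p-q≋[])
  where
  open ≋-Reasoning
  p-q≋[] : p -ₚ q ≋ []
  p-q≋[] = *ₚ-≋[]-cancelʳ n h≡n (begin
    (p +ₚ negₚ q) *ₚ h                 ≈⟨ *ₚ-distribʳ h p (negₚ q) ⟩
    p *ₚ h +ₚ negₚ q *ₚ h              ≈⟨ +ₚ-cong (*ₚ-comm p h) (·ₚ-*ₚ (- 1ℚ) q h) ⟩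
    h *ₚ p +ₚ negₚ (q *ₚ h)            ≈⟨ +ₚ-cong (≋-trans hp≋hq (*ₚ-comm h q)) ≋-refl ⟩
    q *ₚ h -ₚ q *ₚ h                   ≈⟨ -ₚ-self (q *ₚ h) ⟩
    []                                 ∎)

coeff-applyUpTo-< : ∀ f n i → i ℕ.< n → coeff (applyUpTo f n) i ≡ f i
coeff-applyUpTo-< f (suc n) zero    _         = refl
coeff-applyUpTo-< f (suc n) (suc i) (s≤s i<n) = coeff-applyUpTo-< (f ∘ suc) n i i<n

coeff-applyUpTo-≥ : ∀ f n i → n ℕ.≤ i → coeff (applyUpTo f n) i ≡ 0ℚ
coeff-applyUpTo-≥ f zero    i       _         = refl
coeff-applyUpTo-≥ f (suc n) (suc i) (s≤s n≤i) = coeff-applyUpTo-≥ (f ∘ suc) n i n≤i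

DegreeAtMost⇒≋applyUpTo : ∀ {p} n → DegreeAtMost p n → p ≋ applyUpTo (coeff p) (suc n)
DegreeAtMost⇒≋applyUpTo {p} n p≤n = mk≋ coeff-≡-truncation
  where
  coeff-≡-truncation : ∀ i → coeff p i ≡ coeff (applyUpTo (coeff p) (suc n)) i
  coeff-≡-truncation i with ℕ.<-≤-connex i (suc n)
  ... | inj₁ i<n+1 = sym (coeff-applyUpTo-< (coeff p) (suc n) i i<n+1)
  ... | inj₂ n<i   = trans (p≤n i n<i) (sym (coeff-applyUpTo-≥ (coeff p) (suc n) i n<i))

quadratic-cube+1-DegreeAtMost : ∀ a b c → DegreeAtMost (cube (a ∷ b ∷ c ∷ []) +ₚ const 1ℚ) 6
quadratic-cube+1-DegreeAtMost a b c (suc (suc (suc (suc (suc (suc (suc i)))))))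
  (s≤s (s≤s (s≤s (s≤s (s≤s (s≤s (s≤s z≤n))))))) = refl

record ℚ-Algebra : Set₁ where
  field
    commutativeSemiring : CommutativeSemiring 0ℓ 0ℓ
  open CommutativeSemiring commutativeSemiring public
    renaming (_+_ to _⊕_; _*_ to _⊗_; refl to ≈-refl; sym to ≈-sym; trans to ≈-trans)
  field
    ι   : ℚ → Carrier
    ι-0 : ι 0ℚ ≈ 0#
    ι-1 : ι 1ℚ ≈ 1#
    ι-+ : ∀ a b → ι (a + b) ≈ ι a ⊕ ι b
    ι-* : ∀ a b → ι (a * b) ≈ ι a ⊗ ι b

module _ (R : CommutativeSemiring 0ℓ 0ℓ) where
  open CommutativeSemiring R renaming (_+_ to _⊕_; _*_ to _⊗_; refl to ≈-refl; sym to ≈-sym; trans to ≈-trans)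
  open Algebra.Properties.CommutativeSemigroup *-commutativeSemigroup using (interchange)
  open Relation.Binary.Reasoning.Setoid setoid

  cube+1-cong : ∀ {x y} → x ≈ y → x ⊗ x ⊗ x ⊕ 1# ≈ y ⊗ y ⊗ y ⊕ 1#
  cube+1-cong x≈y = +-congʳ (*-cong (*-cong x≈y x≈y) x≈y)

  0³+1≈1 : 0# ⊗ 0# ⊗ 0# ⊕ 1# ≈ 1#
  0³+1≈1 = ≈-trans (+-congʳ (≈-trans (*-congʳ (zeroˡ 0#)) (zeroˡ 0#))) (+-identityˡ 1#)

  cube-inverse : ∀ {w z} → w ⊗ z ≈ 1# → z ⊗ z ⊗ z ⊕ 1# ≈ 0# → w ⊗ w ⊗ w ⊕ 1# ≈ 0#
  cube-inverse {w} {z} wz≈1 z³+1≈0 = begin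
    w ⊗ w ⊗ w ⊕ 1#                          ≈⟨ +-congˡ 1≈[wz]³ ⟩
    w ⊗ w ⊗ w ⊕ (w ⊗ z) ⊗ (w ⊗ z) ⊗ (w ⊗ z)  ≈⟨ +-congˡ [wz]³≈w³z³ ⟩
    w ⊗ w ⊗ w ⊕ (w ⊗ w ⊗ w) ⊗ (z ⊗ z ⊗ z)    ≈⟨ +-congʳ (*-identityʳ _) ⟨
    (w ⊗ w ⊗ w) ⊗ 1# ⊕ (w ⊗ w ⊗ w) ⊗ (z ⊗ z ⊗ z) ≈⟨ distribˡ _ _ _ ⟨
    (w ⊗ w ⊗ w) ⊗ (1# ⊕ z ⊗ z ⊗ z)           ≈⟨ *-congˡ (+-comm 1# _) ⟩
    (w ⊗ w ⊗ w) ⊗ (z ⊗ z ⊗ z ⊕ 1#)           ≈⟨ *-congˡ z³+1≈0 ⟩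
    (w ⊗ w ⊗ w) ⊗ 0#                         ≈⟨ zeroʳ _ ⟩
    0#                                       ∎
    where
    1≈[wz]³ : 1# ≈ (w ⊗ z) ⊗ (w ⊗ z) ⊗ (w ⊗ z)
    1≈[wz]³ = ≈-sym (≈-trans (*-cong (*-cong wz≈1 wz≈1) wz≈1) (≈-trans (*-identityʳ _) (*-identityʳ 1#)))
    [wz]³≈w³z³ : (w ⊗ z) ⊗ (w ⊗ z) ⊗ (w ⊗ z) ≈ (w ⊗ w ⊗ w) ⊗ (z ⊗ z ⊗ z)
    [wz]³≈w³z³ = ≈-trans (*-congʳ (interchange w z w z)) (interchange (w ⊗ w) (z ⊗ z) w z)

module Evaluation (𝒜 : ℚ-Algebra) where
  open ℚ-Algebra 𝒜
  open Relation.Binary.Reasoning.Setoid setoid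
  open Algebra.Properties.CommutativeSemigroup +-commutativeSemigroup using (interchange)
  open Algebra.Properties.CommutativeSemigroup *-commutativeSemigroup using (x∙yz≈y∙xz)

  eval : Poly → Carrier → Carrier
  eval []      θ = 0#
  eval (a ∷ p) θ = ι a ⊕ θ ⊗ eval p θ

  module _ (θ : Carrier) where

    eval-+ₚ : ∀ p q → eval (p +ₚ q) θ ≈ eval p θ ⊕ eval q θ
    eval-+ₚ []      q       = ≈-sym (+-identityˡ _)
    eval-+ₚ (a ∷ p) []      = ≈-sym (+-identityʳ _)
    eval-+ₚ (a ∷ p) (b ∷ q) = begin
      ι (a + b) ⊕ θ ⊗ eval (p +ₚ q) θ                 ≈⟨ +-cong (ι-+ a b) (*-congˡ (eval-+ₚ p q)) ⟩
      (ι a ⊕ ι b) ⊕ θ ⊗ (eval p θ ⊕ eval q θ)         ≈⟨ +-congˡ (distribˡ θ _ _) ⟩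
      (ι a ⊕ ι b) ⊕ (θ ⊗ eval p θ ⊕ θ ⊗ eval q θ)     ≈⟨ interchange (ι a) (ι b) _ _ ⟩
      (ι a ⊕ θ ⊗ eval p θ) ⊕ (ι b ⊕ θ ⊗ eval q θ)     ∎

    eval-·ₚ : ∀ c p → eval (c ·ₚ p) θ ≈ ι c ⊗ eval p θ
    eval-·ₚ c []      = ≈-sym (zeroʳ (ι c))
    eval-·ₚ c (a ∷ p) = begin
      ι (c * a) ⊕ θ ⊗ eval (c ·ₚ p) θ      ≈⟨ +-cong (ι-* c a) (*-congˡ (eval-·ₚ c p)) ⟩
      ι c ⊗ ι a ⊕ θ ⊗ (ι c ⊗ eval p θ)     ≈⟨ +-congˡ (x∙yz≈y∙xz θ (ι c) _) ⟩
      ι c ⊗ ι a ⊕ ι c ⊗ (θ ⊗ eval p θ)     ≈⟨ distribˡ (ι c) _ _ ⟨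
      ι c ⊗ (ι a ⊕ θ ⊗ eval p θ)           ∎

    eval-*ₚ : ∀ p q → eval (p *ₚ q) θ ≈ eval p θ ⊗ eval q θ
    eval-*ₚ []      q = ≈-sym (zeroˡ (eval q θ))
    eval-*ₚ (a ∷ p) q = begin
      eval (a ·ₚ q +ₚ (0ℚ ∷ p *ₚ q)) θ               ≈⟨ eval-+ₚ (a ·ₚ q) _ ⟩
      eval (a ·ₚ q) θ ⊕ (ι 0ℚ ⊕ θ ⊗ eval (p *ₚ q) θ)  ≈⟨ +-cong (eval-·ₚ a q) (≈-trans (+-congʳ ι-0) (+-identityˡ _)) ⟩
      ι a ⊗ eval q θ ⊕ θ ⊗ eval (p *ₚ q) θ            ≈⟨ +-congˡ (*-congˡ (eval-*ₚ p q)) ⟩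
      ι a ⊗ eval q θ ⊕ θ ⊗ (eval p θ ⊗ eval q θ)      ≈⟨ +-congˡ (*-assoc θ _ _) ⟨
      ι a ⊗ eval q θ ⊕ (θ ⊗ eval p θ) ⊗ eval q θ      ≈⟨ distribʳ (eval q θ) (ι a) _ ⟨
      (ι a ⊕ θ ⊗ eval p θ) ⊗ eval q θ                 ∎

    eval-≋[] : ∀ {p} → p ≋ [] → eval p θ ≈ 0#
    eval-≋[] {[]}    _    = ≈-refl
    eval-≋[] {a ∷ p} p≋[] = begin
      ι a ⊕ θ ⊗ eval p θ    ≈⟨ +-cong (≈-trans (reflexive (cong ι (proj₁ (∷-≋[]⁻¹ p≋[])))) ι-0)
                                      (*-congˡ (eval-≋[] (proj₂ (∷-≋[]⁻¹ p≋[])))) ⟩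
      0# ⊕ θ ⊗ 0#            ≈⟨ ≈-trans (+-identityˡ _) (zeroʳ θ) ⟩
      0#                    ∎

    eval-cong : ∀ {p q} → p ≋ q → eval p θ ≈ eval q θ
    eval-cong {[]}    {q}     p≋q = ≈-sym (eval-≋[] (≋-sym p≋q))
    eval-cong {a ∷ p} {[]}    p≋q = eval-≋[] p≋q
    eval-cong {a ∷ p} {b ∷ q} p≋q =
      +-cong (reflexive (cong ι (proj₁ (∷-injective p≋q)))) (*-congˡ (eval-cong (proj₂ (∷-injective p≋q))))

    eval-const : ∀ a → eval (const a) θ ≈ ι a
    eval-const a = ≈-trans (+-congˡ (zeroʳ θ)) (+-identityʳ (ι a))

    eval-linear : ∀ a b → eval (a ∷ b ∷ []) θ ≈ ι a ⊕ θ ⊗ ι b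
    eval-linear a b = +-congˡ (*-congˡ (eval-const b))

    eval-quadratic : ∀ a b c → eval (a ∷ b ∷ c ∷ []) θ ≈ ι a ⊕ θ ⊗ (ι b ⊕ θ ⊗ ι c)
    eval-quadratic a b c = +-congˡ (*-congˡ (eval-linear b c))

    eval-cube+1 : ∀ p → eval (cube p +ₚ const 1ℚ) θ ≈ eval p θ ⊗ eval p θ ⊗ eval p θ ⊕ 1#
    eval-cube+1 p = ≈-trans (eval-+ₚ (cube p) (const 1ℚ))
      (+-cong (≈-trans (eval-*ₚ (p *ₚ p) p) (*-congʳ (eval-*ₚ p p))) (≈-trans (eval-const 1ℚ) ι-1))

ℚ-algebra : ℚ-Algebra
ℚ-algebra = record
  { commutativeSemiring = CommutativeRing.commutativeSemiring ℚ.+-*-commutativeRing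
  ; ι   = λ a → a
  ; ι-0 = refl
  ; ι-1 = refl
  ; ι-+ = λ _ _ → refl
  ; ι-* = λ _ _ → refl
  }

Poly-algebra : ℚ-Algebra
Poly-algebra = record
  { commutativeSemiring = Poly-commutativeSemiring
  ; ι   = const
  ; ι-0 = ∷-≋[] refl ≋-refl
  ; ι-1 = ≋-refl
  ; ι-+ = λ _ _ → ≋-refl
  ; ι-* = λ a b → ∷-cong (sym (ℚ.+-identityʳ (a * b))) ≋-refl
  }

module Composition where
  open Evaluation Poly-algebra

  eval≡∘ₚ : ∀ p h → eval p h ≡ p ∘ₚ h
  eval≡∘ₚ []      h = refl
  eval≡∘ₚ (a ∷ p) h = cong (λ r → const a +ₚ h *ₚ r) (eval≡∘ₚ p h)

  ∘ₚ-congˡ : ∀ {p q} h → p ≋ q → p ∘ₚ h ≋ q ∘ₚ h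
  ∘ₚ-congˡ {p} {q} h p≋q = begin
    p ∘ₚ h     ≡⟨ eval≡∘ₚ p h ⟨
    eval p h   ≈⟨ eval-cong h p≋q ⟩
    eval q h   ≡⟨ eval≡∘ₚ q h ⟩
    q ∘ₚ h     ∎
    where open ≋-Reasoning

  *ₚ-∘ₚ : ∀ p q h → (p *ₚ q) ∘ₚ h ≋ (p ∘ₚ h) *ₚ (q ∘ₚ h)
  *ₚ-∘ₚ p q h = begin
    (p *ₚ q) ∘ₚ h            ≡⟨ eval≡∘ₚ (p *ₚ q) h ⟨
    eval (p *ₚ q) h          ≈⟨ eval-*ₚ h p q ⟩
    eval p h *ₚ eval q h     ≡⟨ cong₂ _*ₚ_ (eval≡∘ₚ p h) (eval≡∘ₚ q h) ⟩
    (p ∘ₚ h) *ₚ (q ∘ₚ h)     ∎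
    where open ≋-Reasoning

  cube+1-∘ₚ : ∀ p h → (cube p +ₚ const 1ℚ) ∘ₚ h ≋ cube (p ∘ₚ h) +ₚ const 1ℚ
  cube+1-∘ₚ p h = begin
    (cube p +ₚ const 1ℚ) ∘ₚ h    ≡⟨ eval≡∘ₚ (cube p +ₚ const 1ℚ) h ⟨
    eval (cube p +ₚ const 1ℚ) h  ≈⟨ eval-cube+1 h p ⟩
    cube (eval p h) +ₚ const 1ℚ  ≡⟨ cong (λ r → cube r +ₚ const 1ℚ) (eval≡∘ₚ p h) ⟩
    cube (p ∘ₚ h) +ₚ const 1ℚ    ∎
    where open ≋-Reasoning

open Composition using (∘ₚ-congˡ; *ₚ-∘ₚ; cube+1-∘ₚ)

cube+1-congₚ : ∀ {p q} → p ≋ q → cube p +ₚ const 1ℚ ≋ cube q +ₚ const 1ℚ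
cube+1-congₚ = cube+1-cong Poly-commutativeSemiring

cube+1-factor-∘ₚ : ∀ h p q s → cube p +ₚ const 1ℚ ≋ q *ₚ s →
                   cube (p ∘ₚ h) +ₚ const 1ℚ ≋ (q ∘ₚ h) *ₚ (s ∘ₚ h)
cube+1-factor-∘ₚ h p q s p³+1≋qs = begin
  cube (p ∘ₚ h) +ₚ const 1ℚ    ≈⟨ cube+1-∘ₚ p h ⟨
  (cube p +ₚ const 1ℚ) ∘ₚ h    ≈⟨ ∘ₚ-congˡ h p³+1≋qs ⟩
  (q *ₚ s) ∘ₚ h                ≈⟨ *ₚ-∘ₚ q s h ⟩
  (q ∘ₚ h) *ₚ (s ∘ₚ h)         ∎
  where open ≋-Reasoning

-- The left-hand sides below are the coefficients exactly as _∘ₚ_ computes them.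
∘ₚ-affine-linear : ∀ a b α β → (a ∷ b ∷ []) ∘ₚ affine α β ≋ (a + b * β ∷ b * α ∷ [])
∘ₚ-affine-linear a b α β = mk≋ λ
  { 0 → coeff₀ a b β ; 1 → coeff₁ b α β ; 2 → coeff₂ α ; (suc (suc (suc i))) → refl }
  where
  coeff₀ : ∀ a b β → a + (β * (b + 0ℚ) + 0ℚ) ≡ a + b * β
  coeff₀ = solve-∀ ℚ-ring
  coeff₁ : ∀ b α β → β * 0ℚ + (α * (b + 0ℚ) + 0ℚ) ≡ b * α
  coeff₁ = solve-∀ ℚ-ring
  coeff₂ : ∀ α → α * 0ℚ ≡ 0ℚ
  coeff₂ = solve-∀ ℚ-ring

∘ₚ-affine-quadratic : ∀ a b c α β → (a ∷ b ∷ c ∷ []) ∘ₚ affine α β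
                      ≋ (a + b * β + c * β * β ∷ b * α + (c * α * β + c * α * β) ∷ c * α * α ∷ [])
∘ₚ-affine-quadratic a b c α β = mk≋ λ
  { 0 → coeff₀ a b c β ; 1 → coeff₁ b c α β ; 2 → coeff₂ c α β ; 3 → coeff₃ α
  ; (suc (suc (suc (suc i)))) → refl }
  where
  coeff₀ : ∀ a b c β → a + (β * (b + (β * (c + 0ℚ) + 0ℚ)) + 0ℚ) ≡ a + b * β + c * β * β
  coeff₀ = solve-∀ ℚ-ring
  coeff₁ : ∀ b c α β → β * (β * 0ℚ + (α * (c + 0ℚ) + 0ℚ)) + (α * (b + (β * (c + 0ℚ) + 0ℚ)) + 0ℚ)
                     ≡ b * α + (c * α * β + c * α * β)
  coeff₁ = solve-∀ ℚ-ring
  coeff₂ : ∀ c α β → β * (α * 0ℚ) + α * (β * 0ℚ + (α * (c + 0ℚ) + 0ℚ)) ≡ c * α * α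
  coeff₂ = solve-∀ ℚ-ring
  coeff₃ : ∀ α → α * (α * 0ℚ) ≡ 0ℚ
  coeff₃ = solve-∀ ℚ-ring

-- ℚ[ε]/(ε² - c₁ ε - c₀); the pair (u , v) stands for u + v ε. The solver identities quantify
-- over k₀ k₁ rather than mention the parameters c₀ c₁, which it would treat as constants.
module QuadraticAlgebra (c₀ c₁ : ℚ) where

  infixl 7 _⊗_
  _⊗_ : ℚ × ℚ → ℚ × ℚ → ℚ × ℚ
  (a , b) ⊗ (c , d) = a * c + b * d * c₀ , a * d + b * c + b * d * c₁

  private
    +-commutativeMonoid : CommutativeMonoid 0ℓ 0ℓ
    +-commutativeMonoid = DirectProduct.commutativeMonoid ℚ.+-0-commutativeMonoid ℚ.+-0-commutativeMonoid

    open CommutativeMonoid +-commutativeMonoid using (_≈_; isEquivalence) renaming (_∙_ to infixl 6 _⊕_)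

    ⊗-assoc : ∀ x y z → (x ⊗ y) ⊗ z ≈ x ⊗ (y ⊗ z)
    ⊗-assoc (a , b) (c , d) (e , f) = assoc₁ c₀ c₁ a b c d e f , assoc₂ c₀ c₁ a b c d e f
      where
      assoc₁ : ∀ k₀ k₁ a b c d e f →
        (a * c + b * d * k₀) * e + (a * d + b * c + b * d * k₁) * f * k₀
        ≡ a * (c * e + d * f * k₀) + b * (c * f + d * e + d * f * k₁) * k₀
      assoc₁ = solve-∀ ℚ-ring
      assoc₂ : ∀ k₀ k₁ a b c d e f →
        (a * c + b * d * k₀) * f + (a * d + b * c + b * d * k₁) * e + (a * d + b * c + b * d * k₁) * f * k₁
        ≡ a * (c * f + d * e + d * f * k₁) + b * (c * e + d * f * k₀)
          + b * (c * f + d * e + d * f * k₁) * k₁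
      assoc₂ = solve-∀ ℚ-ring

    ⊗-comm : ∀ x y → x ⊗ y ≈ y ⊗ x
    ⊗-comm (a , b) (c , d) = comm₁ c₀ a b c d , comm₂ c₁ a b c d
      where
      comm₁ : ∀ k₀ a b c d → a * c + b * d * k₀ ≡ c * a + d * b * k₀
      comm₁ = solve-∀ ℚ-ring
      comm₂ : ∀ k₁ a b c d → a * d + b * c + b * d * k₁ ≡ c * b + d * a + d * b * k₁
      comm₂ = solve-∀ ℚ-ring

    ⊗-identityˡ : ∀ x → (1ℚ , 0ℚ) ⊗ x ≈ x
    ⊗-identityˡ (a , b) = identity₁ c₀ a b , identity₂ c₁ a b
      where
      identity₁ : ∀ k₀ a b → 1ℚ * a + 0ℚ * b * k₀ ≡ a
      identity₁ = solve-∀ ℚ-ring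
      identity₂ : ∀ k₁ a b → 1ℚ * b + 0ℚ * a + 0ℚ * b * k₁ ≡ b
      identity₂ = solve-∀ ℚ-ring

    ⊗-distribʳ : ∀ x y z → (y ⊕ z) ⊗ x ≈ y ⊗ x ⊕ z ⊗ x
    ⊗-distribʳ (a , b) (c , d) (e , f) = distrib₁ c₀ a b c d e f , distrib₂ c₁ a b c d e f
      where
      distrib₁ : ∀ k₀ a b c d e f →
        (c + e) * a + (d + f) * b * k₀ ≡ (c * a + d * b * k₀) + (e * a + f * b * k₀)
      distrib₁ = solve-∀ ℚ-ring
      distrib₂ : ∀ k₁ a b c d e f →
        (c + e) * b + (d + f) * a + (d + f) * b * k₁
        ≡ (c * b + d * a + d * b * k₁) + (e * b + f * a + f * b * k₁)
      distrib₂ = solve-∀ ℚ-ring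

    ⊗-zeroˡ : ∀ x → (0ℚ , 0ℚ) ⊗ x ≈ (0ℚ , 0ℚ)
    ⊗-zeroˡ (a , b) = zero₁ c₀ a b , zero₂ c₁ a b
      where
      zero₁ : ∀ k₀ a b → 0ℚ * a + 0ℚ * b * k₀ ≡ 0ℚ
      zero₁ = solve-∀ ℚ-ring
      zero₂ : ∀ k₁ a b → 0ℚ * b + 0ℚ * a + 0ℚ * b * k₁ ≡ 0ℚ
      zero₂ = solve-∀ ℚ-ring

    ι-* : ∀ a b → (a * b , 0ℚ) ≈ (a , 0ℚ) ⊗ (b , 0ℚ)
    ι-* a b = homo₁ c₀ a b , homo₂ c₁ a b
      where
      homo₁ : ∀ k₀ a b → a * b ≡ a * b + 0ℚ * 0ℚ * k₀
      homo₁ = solve-∀ ℚ-ring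
      homo₂ : ∀ k₁ a b → 0ℚ ≡ a * 0ℚ + 0ℚ * b + 0ℚ * 0ℚ * k₁
      homo₂ = solve-∀ ℚ-ring

  algebra : ℚ-Algebra
  algebra = record
    { commutativeSemiring = record
      { isCommutativeSemiring = isCommutativeSemiringˡ record
        { +-isCommutativeMonoid = CommutativeMonoid.isCommutativeMonoid +-commutativeMonoid
        ; *-isCommutativeMonoid = isCommutativeMonoidˡ record
          { isSemigroup = record
            { isMagma = record
              { isEquivalence = isEquivalence
              ; ∙-cong        = λ { (refl , refl) (refl , refl) → refl , refl }
              }
            ; assoc = ⊗-assoc
            }
          ; identityˡ = ⊗-identityˡ
          ; comm      = ⊗-comm
          }
        ; distribʳ = ⊗-distribʳ
        ; zeroˡ    = ⊗-zeroˡ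
        }
      }
    ; ι   = λ a → a , 0ℚ
    ; ι-0 = refl , refl
    ; ι-1 = refl , refl
    ; ι-+ = λ a b → refl , sym (ℚ.+-identityˡ 0ℚ)
    ; ι-* = ι-*
    }

  open ℚ-Algebra algebra using (1#)
  open Evaluation algebra

  module _ (x : ℚ) where

    eval-∷-at : ∀ a p {u v} → eval p (x , 1ℚ) ≈ (u , v) →
                eval (a ∷ p) (x , 1ℚ) ≈ (a + x * u + v * c₀ , u + x * v + v * c₁)
    eval-∷-at a p {u} {v} (refl , refl) = step₁ c₀ a u v x , step₂ c₁ u v x
      where
      step₁ : ∀ k₀ a u v x → a + (x * u + 1ℚ * v * k₀) ≡ a + x * u + v * k₀
      step₁ = solve-∀ ℚ-ring
      step₂ : ∀ k₁ u v x → 0ℚ + (x * v + 1ℚ * u + 1ℚ * v * k₁) ≡ u + x * v + v * k₁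
      step₂ = solve-∀ ℚ-ring

    eval-linear-at : ∀ a b → eval (a ∷ b ∷ []) (x , 1ℚ) ≈ (a + x * b , b)
    eval-linear-at a b = trans (proj₁ horner) (step₁ c₀ a b x) , trans (proj₂ horner) (step₂ c₁ b x)
      where
      horner : eval (a ∷ b ∷ []) (x , 1ℚ) ≈ (a + x * b + 0ℚ * c₀ , b + x * 0ℚ + 0ℚ * c₁)
      horner = eval-∷-at a (b ∷ []) (eval-const (x , 1ℚ) b)
      step₁ : ∀ k₀ a b x → a + x * b + 0ℚ * k₀ ≡ a + x * b
      step₁ = solve-∀ ℚ-ring
      step₂ : ∀ k₁ b x → b + x * 0ℚ + 0ℚ * k₁ ≡ b
      step₂ = solve-∀ ℚ-ring

    eval-quadratic-at : ∀ a b c → eval (a ∷ b ∷ c ∷ []) (x , 1ℚ)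
                        ≈ (a + x * (b + x * c) + c * c₀ , b + x * c + x * c + c * c₁)
    eval-quadratic-at a b c = eval-∷-at a (b ∷ c ∷ []) (eval-linear-at b c)

  cube-ε-multiple : ∀ q → (0ℚ , q) ⊗ (0ℚ , q) ⊗ (0ℚ , q) ⊕ 1#
                          ≈ (q * q * q * (c₀ * c₁) + 1ℚ , q * q * q * (c₀ + c₁ * c₁))
  cube-ε-multiple q = cube₁ c₀ c₁ q , cube₂ c₀ c₁ q
    where
    cube₁ : ∀ k₀ k₁ q →
      (0ℚ * 0ℚ + q * q * k₀) * 0ℚ + (0ℚ * q + q * 0ℚ + q * q * k₁) * q * k₀ + 1ℚ
      ≡ q * q * q * (k₀ * k₁) + 1ℚ
    cube₁ = solve-∀ ℚ-ring
    cube₂ : ∀ k₀ k₁ q →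
      (0ℚ * 0ℚ + q * q * k₀) * q + (0ℚ * q + q * 0ℚ + q * q * k₁) * 0ℚ
        + (0ℚ * q + q * 0ℚ + q * q * k₁) * q * k₁ + 0ℚ
      ≡ q * q * q * (k₀ + k₁ * k₁)
    cube₂ = solve-∀ ℚ-ring

substitution-divides : ∀ h p q r {p′ q′} → cube p +ₚ const 1ℚ ≋ r *ₚ q →
                       p′ ≋ p ∘ₚ h → q′ ≋ q ∘ₚ h → q′ ∣ₚ cube p′ +ₚ const 1ℚ
substitution-divides h p q r {p′} {q′} p³+1≋rq p′≋ q′≋ = r ∘ₚ h , ≋⇒≈ₚ (begin
  cube p′ +ₚ const 1ℚ        ≈⟨ cube+1-congₚ p′≋ ⟩
  cube (p ∘ₚ h) +ₚ const 1ℚ  ≈⟨ cube+1-factor-∘ₚ h p r q p³+1≋rq ⟩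
  (r ∘ₚ h) *ₚ (q ∘ₚ h)       ≈⟨ *ₚ-congʳ (r ∘ₚ h) (≋-sym q′≋) ⟩
  (r ∘ₚ h) *ₚ q′             ∎)
  where open ≋-Reasoning

≋-by-computation : ∀ p q → {True (all? (_≟ 0ℚ) (p -ₚ q))} → p ≋ q
≋-by-computation p q {p-q≡0} = ≈ₚ⇒≋ (toWitness p-q≡0)

U : Poly
U = 1ℚ ∷ - 1ℚ ∷ []

V : Poly
V = - 1ℚ ∷ - 1ℚ ∷ 0ℚ ∷ - nat 26 ∷ nat 55 ∷ - nat 108 ∷ nat 134 ∷ - nat 145 ∷ nat 117 ∷ - nat 81
  ∷ nat 42 ∷ - nat 18 ∷ nat 5 ∷ - 1ℚ ∷ []

F³+1≋U*G : cube F +ₚ const 1ℚ ≋ U *ₚ G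
F³+1≋U*G = ≋-by-computation _ _

G³+1≋V*F : cube G +ₚ const 1ℚ ≋ V *ₚ F
G³+1≋V*F = ≋-by-computation _ _

composed-solution-divides : ∀ h {f g} → f ≋ F ∘ₚ h → g ≋ G ∘ₚ h →
                            (g ∣ₚ cube f +ₚ const 1ℚ) × (f ∣ₚ cube g +ₚ const 1ℚ)
composed-solution-divides h f≋ g≋ =
  substitution-divides h F G U F³+1≋U*G f≋ g≋ , substitution-divides h G F V G³+1≋V*F g≋ f≋

module FromDivisibility {f g Q R : Poly} (f≡2 : HasDegree f 2) (g≡5 : HasDegree g 5)
               (f³+1≋Qg : cube f +ₚ const 1ℚ ≋ Q *ₚ g) (g³+1≋Rf : cube g +ₚ const 1ℚ ≋ R *ₚ f) where

  f₀ f₁ a : ℚ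
  f₀ = coeff f 0
  f₁ = coeff f 1
  a  = coeff f 2

  a≢0 : a ≢ 0ℚ
  a≢0 = proj₁ f≡2

  f̂ : Poly
  f̂ = f₀ ∷ f₁ ∷ a ∷ []

  f≋f̂ : f ≋ f̂
  f≋f̂ = DegreeAtMost⇒≋applyUpTo 2 (proj₂ f≡2)

  Q≤1 : DegreeAtMost Q 1
  Q≤1 = *ₚ-DegreeAtMost-cancelʳ {Q} {g} 1 5 g≡5 (DegreeAtMost-cong {n = 1 ℕ.+ 5}
          (≋-trans (cube+1-congₚ (≋-sym f≋f̂)) f³+1≋Qg) (quadratic-cube+1-DegreeAtMost f₀ f₁ a))

  q₀ q₁ : ℚ
  q₀ = coeff Q 0
  q₁ = coeff Q 1

  Q̂ : Poly
  Q̂ = q₀ ∷ q₁ ∷ []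

  f̂³+1≋Q̂g : cube f̂ +ₚ const 1ℚ ≋ Q̂ *ₚ g
  f̂³+1≋Q̂g = ≋-trans (cube+1-congₚ (≋-sym f≋f̂))
    (≋-trans f³+1≋Qg (*ₚ-congˡ g (DegreeAtMost⇒≋applyUpTo {Q} 1 Q≤1)))

  Q̂≤1 : DegreeAtMost Q̂ 1
  Q̂≤1 (suc (suc i)) (s≤s (s≤s z≤n)) = refl

  q₁≢0 : q₁ ≢ 0ℚ
  q₁≢0 q₁≡0 = x≢0⇒x³≢0 a≢0 (begin
    a * a * a                   ≡⟨ coeff-≡ f̂³+1≋Q̂g 6 ⟩
    coeff (Q̂ *ₚ g) (1 ℕ.+ 5)   ≡⟨ coeff-*ₚ-top Q̂ g 1 5 Q̂≤1 (proj₂ g≡5) ⟩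
    q₁ * coeff g 5              ≡⟨ cong (_* coeff g 5) q₁≡0 ⟩
    0ℚ * coeff g 5              ≡⟨ ℚ.*-zeroˡ (coeff g 5) ⟩
    0ℚ                          ∎)
    where open ≡-Reasoning

  Q̂≡1 : HasDegree Q̂ 1
  Q̂≡1 = q₁≢0 , Q̂≤1

  x₀ : ℚ
  x₀ = proj₁ (linear-root q₀ q₁ q₁≢0)

  Q̂[x₀]≡0 : q₀ + x₀ * q₁ ≡ 0ℚ
  Q̂[x₀]≡0 = proj₂ (linear-root q₀ q₁ q₁≢0)

  f̂[x₀]≡-1 : f₀ + x₀ * (f₁ + x₀ * a) ≡ - 1ℚ
  f̂[x₀]≡-1 = x³+1≡0⇒x≡-1 (begin
    f̂x₀ * f̂x₀ * f̂x₀ + 1ℚ                   ≡⟨ cong (λ y → y * y * y + 1ℚ) (eval-quadratic x₀ f₀ f₁ a) ⟨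
    eval f̂ x₀ * eval f̂ x₀ * eval f̂ x₀ + 1ℚ  ≡⟨ eval-cube+1 x₀ f̂ ⟨
    eval (cube f̂ +ₚ const 1ℚ) x₀            ≡⟨ eval-cong x₀ f̂³+1≋Q̂g ⟩
    eval (Q̂ *ₚ g) x₀                        ≡⟨ eval-*ₚ x₀ Q̂ g ⟩
    eval Q̂ x₀ * eval g x₀                   ≡⟨ cong (_* eval g x₀) (trans (eval-linear x₀ q₀ q₁) Q̂[x₀]≡0) ⟩
    0ℚ * eval g x₀                          ≡⟨ ℚ.*-zeroˡ (eval g x₀) ⟩
    0ℚ                                      ∎)
    where
    open ≡-Reasoning
    open Evaluation ℚ-algebra
    f̂x₀ : ℚ
    f̂x₀ = f₀ + x₀ * (f₁ + x₀ * a)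

  -- b = f′(x₀)
  b : ℚ
  b = f₁ + x₀ * a + x₀ * a

  -- Since f̂(x₀ + ε) = -1 + b ε + a ε², these make θ = x₀ + ε a root of f̂.
  c₀ c₁ : ℚ
  c₀ = 1/ a
    where instance _ = ≢-nonZero a≢0
  c₁ = - (b * c₀)

  a*c₀≡1 : a * c₀ ≡ 1ℚ
  a*c₀≡1 = ℚ.*-inverseʳ a
    where instance _ = ≢-nonZero a≢0

  open QuadraticAlgebra c₀ c₁ using (algebra; eval-linear-at; eval-quadratic-at; cube-ε-multiple)
  module K = ℚ-Algebra algebra
  open Evaluation algebra using () renaming (eval to evalK; eval-cong to evalK-cong; eval-*ₚ to evalK-*ₚ;
                                               eval-cube+1 to evalK-cube+1)

  θ : ℚ × ℚ
  θ = x₀ , 1ℚ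

  f̂[θ]≈0 : evalK f̂ θ K.≈ K.0#
  f̂[θ]≈0 = trans (proj₁ taylor) (trans (cong₂ _+_ f̂[x₀]≡-1 a*c₀≡1) (ℚ.+-inverseˡ 1ℚ))
         , trans (proj₂ taylor) (trans (b+a[-bc]≡b[1-ac] a b c₀)
             (trans (cong (λ t → b * (1ℚ - t)) a*c₀≡1) (b[1-1]≡0 b)))
    where
    taylor : evalK f̂ θ K.≈ (f₀ + x₀ * (f₁ + x₀ * a) + a * c₀ , b + a * c₁)
    taylor = eval-quadratic-at x₀ f₀ f₁ a
    b+a[-bc]≡b[1-ac] : ∀ a b c → b + a * - (b * c) ≡ b * (1ℚ - a * c)
    b+a[-bc]≡b[1-ac] = solve-∀ ℚ-ring
    b[1-1]≡0 : ∀ b → b * (1ℚ - 1ℚ) ≡ 0ℚ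
    b[1-1]≡0 = solve-∀ ℚ-ring

  Q̂[θ]≈q₁ε : evalK Q̂ θ K.≈ (0ℚ , q₁)
  Q̂[θ]≈q₁ε = trans (proj₁ (eval-linear-at x₀ q₀ q₁)) Q̂[x₀]≡0 , proj₂ (eval-linear-at x₀ q₀ q₁)

  Q̂[θ]*g[θ]≈1 : evalK Q̂ θ K.⊗ evalK g θ K.≈ K.1#
  Q̂[θ]*g[θ]≈1 = begin
    evalK Q̂ θ K.⊗ evalK g θ                              ≈⟨ evalK-*ₚ θ Q̂ g ⟨
    evalK (Q̂ *ₚ g) θ                                     ≈⟨ evalK-cong θ f̂³+1≋Q̂g ⟨
    evalK (cube f̂ +ₚ const 1ℚ) θ                         ≈⟨ evalK-cube+1 θ f̂ ⟩
    evalK f̂ θ K.⊗ evalK f̂ θ K.⊗ evalK f̂ θ K.⊕ K.1#       ≈⟨ cube+1-cong K.commutativeSemiring {evalK f̂ θ} f̂[θ]≈0 ⟩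
    K.0# K.⊗ K.0# K.⊗ K.0# K.⊕ K.1#                      ≈⟨ 0³+1≈1 K.commutativeSemiring ⟩
    K.1#                                                 ∎
    where open Relation.Binary.Reasoning.Setoid K.setoid

  g[θ]³+1≈0 : evalK g θ K.⊗ evalK g θ K.⊗ evalK g θ K.⊕ K.1# K.≈ K.0#
  g[θ]³+1≈0 = begin
    evalK g θ K.⊗ evalK g θ K.⊗ evalK g θ K.⊕ K.1#   ≈⟨ evalK-cube+1 θ g ⟨
    evalK (cube g +ₚ const 1ℚ) θ                    ≈⟨ evalK-cong θ g³+1≋Rf ⟩
    evalK (R *ₚ f) θ                                ≈⟨ evalK-*ₚ θ R f ⟩
    evalK R θ K.⊗ evalK f θ                         ≈⟨ K.*-congˡ {evalK R θ} (K.≈-trans (evalK-cong θ f≋f̂) f̂[θ]≈0) ⟩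
    evalK R θ K.⊗ K.0#                              ≈⟨ K.zeroʳ (evalK R θ) ⟩
    K.0#                                            ∎
    where open Relation.Binary.Reasoning.Setoid K.setoid

  ε-equations : q₁ * q₁ * q₁ * (c₀ * c₁) + 1ℚ ≡ 0ℚ × q₁ * q₁ * q₁ * (c₀ + c₁ * c₁) ≡ 0ℚ
  ε-equations = begin
    (q₁ * q₁ * q₁ * (c₀ * c₁) + 1ℚ , q₁ * q₁ * q₁ * (c₀ + c₁ * c₁))
      ≈⟨ cube-ε-multiple q₁ ⟨
    (0ℚ , q₁) K.⊗ (0ℚ , q₁) K.⊗ (0ℚ , q₁) K.⊕ K.1#
      ≈⟨ cube+1-cong K.commutativeSemiring {0ℚ , q₁} {evalK Q̂ θ} (K.≈-sym {evalK Q̂ θ} Q̂[θ]≈q₁ε) ⟩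
    evalK Q̂ θ K.⊗ evalK Q̂ θ K.⊗ evalK Q̂ θ K.⊕ K.1#
      ≈⟨ cube-inverse K.commutativeSemiring {evalK Q̂ θ} {evalK g θ} Q̂[θ]*g[θ]≈1 g[θ]³+1≈0 ⟩
    K.0#
      ∎
    where open Relation.Binary.Reasoning.Setoid K.setoid

  c₀+c₁²≡0 : c₀ + c₁ * c₁ ≡ 0ℚ
  c₀+c₁²≡0 = x≢0∧x*y≡0⇒y≡0 (x≢0⇒x³≢0 q₁≢0) (proj₂ ε-equations)

  a≡-b² : a ≡ - (b * b)
  a≡-b² = x-y≡0⇒x≡y (begin
    a - - (b * b)                                    ≡⟨ expand a b ⟩
    a * 1ℚ + (b * 1ℚ) * (b * 1ℚ)                     ≡⟨ cong (λ t → a * t + (b * t) * (b * t)) a*c₀≡1 ⟨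
    a * (a * c₀) + (b * (a * c₀)) * (b * (a * c₀))   ≡⟨ factor a b c₀ ⟨
    a * a * (c₀ + c₁ * c₁)                           ≡⟨ cong (a * a *_) c₀+c₁²≡0 ⟩
    a * a * 0ℚ                                       ≡⟨ ℚ.*-zeroʳ (a * a) ⟩
    0ℚ                                               ∎)
    where
    open ≡-Reasoning
    expand : ∀ a b → a - - (b * b) ≡ a * 1ℚ + (b * 1ℚ) * (b * 1ℚ)
    expand = solve-∀ ℚ-ring
    factor : ∀ a b c → a * a * (c + - (b * c) * - (b * c)) ≡ a * (a * c) + (b * (a * c)) * (b * (a * c))
    factor = solve-∀ ℚ-ring

  q₁³b≡a² : q₁ * q₁ * q₁ * b ≡ a * a
  q₁³b≡a² = sym (x-y≡0⇒x≡y (begin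
    a * a - q₁ * q₁ * q₁ * b                                 ≡⟨ expand a b q₁ ⟩
    a * a - q₁ * q₁ * q₁ * b * (1ℚ * 1ℚ)                     ≡⟨ cong (λ t → a * a - q₁ * q₁ * q₁ * b * (t * t)) a*c₀≡1 ⟨
    a * a - q₁ * q₁ * q₁ * b * ((a * c₀) * (a * c₀))         ≡⟨ factor a b c₀ q₁ ⟨
    a * a * (q₁ * q₁ * q₁ * (c₀ * c₁) + 1ℚ)                  ≡⟨ cong (a * a *_) (proj₁ ε-equations) ⟩
    a * a * 0ℚ                                               ≡⟨ ℚ.*-zeroʳ (a * a) ⟩
    0ℚ                                                       ∎))
    where
    open ≡-Reasoning
    expand : ∀ a b q → a * a - q * q * q * b ≡ a * a - q * q * q * b * (1ℚ * 1ℚ)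
    expand = solve-∀ ℚ-ring
    factor : ∀ a b c q →
      a * a * (q * q * q * (c * - (b * c)) + 1ℚ) ≡ a * a - q * q * q * b * ((a * c) * (a * c))
    factor = solve-∀ ℚ-ring

  b≢0 : b ≢ 0ℚ
  b≢0 b≡0 = a≢0 (trans a≡-b² (cong (λ t → - (t * t)) b≡0))

  q₁≡b : q₁ ≡ b
  q₁≡b = cube-injective (x-y≡0⇒x≡y (y≢0∧x*y≡0⇒x≡0 b≢0 (begin
    (q₁ * q₁ * q₁ - b * b * b) * b                    ≡⟨ expand q₁ b ⟩
    q₁ * q₁ * q₁ * b - (- (b * b)) * (- (b * b))      ≡⟨ cong (λ t → q₁ * q₁ * q₁ * b - t * t) a≡-b² ⟨
    q₁ * q₁ * q₁ * b - a * a                          ≡⟨ cong (_- a * a) q₁³b≡a² ⟩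
    a * a - a * a                                     ≡⟨ ℚ.+-inverseʳ (a * a) ⟩
    0ℚ                                                ∎)))
    where
    open ≡-Reasoning
    expand : ∀ q b → (q * q * q - b * b * b) * b ≡ q * q * q * b - (- (b * b)) * (- (b * b))
    expand = solve-∀ ℚ-ring

  α β : ℚ
  α = - b
  β = 1ℚ + b * x₀

  α≢0 : α ≢ 0ℚ
  α≢0 α≡0 = b≢0 (ℚ.neg-injective α≡0)

  f̂≋F∘ℓ : f̂ ≋ F ∘ₚ affine α β
  f̂≋F∘ℓ = ≋-trans (∷-cong f₀≡ (∷-cong f₁≡ (∷-cong a≡ ≋-refl)))
                  (≋-sym (∘ₚ-affine-quadratic (- 1ℚ) 1ℚ (- 1ℚ) α β))
    where
    open ≡-Reasoning
    a≡ : a ≡ - 1ℚ * α * α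
    a≡ = trans a≡-b² (square b)
      where
      square : ∀ b → - (b * b) ≡ - 1ℚ * (- b) * (- b)
      square = solve-∀ ℚ-ring
    f₁≡ : f₁ ≡ 1ℚ * α + (- 1ℚ * α * β + - 1ℚ * α * β)
    f₁≡ = begin
      f₁                                          ≡⟨ f₁-from-b f₁ x₀ a ⟩
      b - (x₀ * a + x₀ * a)                       ≡⟨ cong (λ t → b - (x₀ * t + x₀ * t)) a≡-b² ⟩
      b - (x₀ * - (b * b) + x₀ * - (b * b))       ≡⟨ linear-coefficient b x₀ ⟩
      1ℚ * α + (- 1ℚ * α * β + - 1ℚ * α * β)      ∎
      where
      f₁-from-b : ∀ f₁ x a → f₁ ≡ (f₁ + x * a + x * a) - (x * a + x * a)
      f₁-from-b = solve-∀ ℚ-ring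
      linear-coefficient : ∀ b x → b - (x * - (b * b) + x * - (b * b))
                         ≡ 1ℚ * (- b) + (- 1ℚ * (- b) * (1ℚ + b * x) + - 1ℚ * (- b) * (1ℚ + b * x))
      linear-coefficient = solve-∀ ℚ-ring
    f₀≡ : f₀ ≡ - 1ℚ + 1ℚ * β + - 1ℚ * β * β
    f₀≡ = begin
      f₀                                              ≡⟨ f₀-from-value f₀ f₁ x₀ a ⟩
      (f₀ + x₀ * (f₁ + x₀ * a)) - x₀ * (b - x₀ * a)   ≡⟨ cong (_- x₀ * (b - x₀ * a)) f̂[x₀]≡-1 ⟩
      - 1ℚ - x₀ * (b - x₀ * a)                        ≡⟨ cong (λ t → - 1ℚ - x₀ * (b - x₀ * t)) a≡-b² ⟩
      - 1ℚ - x₀ * (b - x₀ * - (b * b))                ≡⟨ constant-coefficient b x₀ ⟩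
      - 1ℚ + 1ℚ * β + - 1ℚ * β * β                    ∎
      where
      f₀-from-value : ∀ f₀ f₁ x a → f₀ ≡ (f₀ + x * (f₁ + x * a)) - x * ((f₁ + x * a + x * a) - x * a)
      f₀-from-value = solve-∀ ℚ-ring
      constant-coefficient : ∀ b x → - 1ℚ - x * (b - x * - (b * b))
                           ≡ - 1ℚ + 1ℚ * (1ℚ + b * x) + - 1ℚ * (1ℚ + b * x) * (1ℚ + b * x)
      constant-coefficient = solve-∀ ℚ-ring

  Q̂≋U∘ℓ : Q̂ ≋ U ∘ₚ affine α β
  Q̂≋U∘ℓ = ≋-trans (∷-cong q₀≡ (∷-cong q₁≡ ≋-refl)) (≋-sym (∘ₚ-affine-linear 1ℚ (- 1ℚ) α β))
    where
    open ≡-Reasoning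
    q₀≡ : q₀ ≡ 1ℚ + - 1ℚ * β
    q₀≡ = begin
      q₀                          ≡⟨ q₀-from-root q₀ q₁ x₀ ⟩
      (q₀ + x₀ * q₁) - x₀ * q₁    ≡⟨ cong₂ (λ s t → s - x₀ * t) Q̂[x₀]≡0 q₁≡b ⟩
      0ℚ - x₀ * b                 ≡⟨ constant-coefficient b x₀ ⟩
      1ℚ + - 1ℚ * β               ∎
      where
      q₀-from-root : ∀ q₀ q₁ x → q₀ ≡ (q₀ + x * q₁) - x * q₁
      q₀-from-root = solve-∀ ℚ-ring
      constant-coefficient : ∀ b x → 0ℚ - x * b ≡ 1ℚ + - 1ℚ * (1ℚ + b * x)
      constant-coefficient = solve-∀ ℚ-ring
    q₁≡ : q₁ ≡ - 1ℚ * α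
    q₁≡ = trans q₁≡b (linear-coefficient b)
      where
      linear-coefficient : ∀ b → b ≡ - 1ℚ * (- b)
      linear-coefficient = solve-∀ ℚ-ring

  g≋G∘ℓ : g ≋ G ∘ₚ affine α β
  g≋G∘ℓ = *ₚ-cancelˡ 1 Q̂≡1 (begin
    Q̂ *ₚ g                                  ≈⟨ f̂³+1≋Q̂g ⟨
    cube f̂ +ₚ const 1ℚ                      ≈⟨ cube+1-congₚ f̂≋F∘ℓ ⟩
    cube (F ∘ₚ ℓ) +ₚ const 1ℚ               ≈⟨ cube+1-factor-∘ₚ ℓ F U G F³+1≋U*G ⟩
    (U ∘ₚ ℓ) *ₚ (G ∘ₚ ℓ)                    ≈⟨ *ₚ-congˡ (G ∘ₚ ℓ) Q̂≋U∘ℓ ⟨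
    Q̂ *ₚ (G ∘ₚ ℓ)                           ∎)
    where
    open ≋-Reasoning
    ℓ : Poly
    ℓ = affine α β

  affine-solution : Σ ℚ λ α → Σ ℚ λ β → (α ≢ 0ℚ) × (f ≈ₚ F ∘ₚ affine α β) × (g ≈ₚ G ∘ₚ affine α β)
  affine-solution = α , β , α≢0 , ≋⇒≈ₚ (≋-trans f≋f̂ f̂≋F∘ℓ) , ≋⇒≈ₚ g≋G∘ℓ

theorem2p5 : (f g : Poly) → HasDegree f 2 → HasDegree g 5 →
    ((g ∣ₚ (cube f +ₚ const 1ℚ)) × (f ∣ₚ (cube g +ₚ const 1ℚ)))
    ⇔ Σ ℚ (λ α → Σ ℚ (λ β → (α ≢ 0ℚ) × (f ≈ₚ F ∘ₚ affine α β) × (g ≈ₚ G ∘ₚ affine α β)))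
theorem2p5 f g f≡2 g≡5 = mk⇔
  (λ { ((Q , f³+1≈Qg) , (R , g³+1≈Rf)) →
       FromDivisibility.affine-solution {Q = Q} {R = R} f≡2 g≡5 (≈ₚ⇒≋ f³+1≈Qg) (≈ₚ⇒≋ g³+1≈Rf) })
  (λ { (α , β , _ , f≈ , g≈) →
       composed-solution-divides (affine α β) (≈ₚ⇒≋ f≈) (≈ₚ⇒≋ g≈) })
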